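{- Let \(G=(U\sqcup V,E)\) be a finite simple bipartite graph with \(|U|=|V|=n\). If \(\operatorname{pf}(G)\le k\), then there exist sign matrices \(S_1,\dots,S_k\in\{\pm1\}^{n\times n}\) and real numbers \(c_1,\dots,c_k\) such that \[ \operatorname{per}(B_G)=\sum_{i=1}^k c_i\det(S_i\circ B_G) \] as polynomials in the edge variables.
   Context: Assign an independent variable \(x_e\) to each edge \(e\). The weighted biadjacency matrix \(B_G\) is the \(n\times n\) matrix with rows indexed by \(U\), columns by \(V\), and \((B_G)_{uv}=x_{uv}\) if \(uv\in E\), \(0\) otherwise; \(\operatorname{per}\) is the permanent and \(\circ\) the entrywise product. The perfect-matching polynomial is \(\mathrm{PM}(G)=\sum_{M}\prod_{e\in M}x_e\) over perfect matchings \(M\). Fix an ordering of the vertices; for an orientation \(D\) of \(G\), the weighted skew-adjacency matrix \(A_D\) has \((A_D)_{ij}=x_{ij}\) if \(ij\) is an edge oriented from \(i\) to \(j\), \(-x_{ij}\) if oriented from \(j\) to \(i\), and \(0\) otherwise, with Pfaffian \(\mathrm{Pf}(A_D)\). \(G\) is \(k\)-Pfaffian if there are orientations \(D_1,\dots,D_k\) and reals \(c_1,\dots,c_k\) with \(\mathrm{PM}(G)=\sum_i c_i\mathrm{Pf}(A_{D_i})\); \(\operatorname{pf}(G)\) is the least positive integer \(k\) for which \(G\) is \(k\)-Pfaffian. -}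

module Defs where

open import Level using (_⊔_)
open import Algebra.Bundles using (CommutativeRing)
open import Data.Nat using (ℕ; zero; suc; _+_; _≤_)
open import Data.Fin using (Fin; zero; suc; punchIn; splitAt; toℕ)
open import Data.Bool using (Bool; true; false; if_then_else_)
open import Data.Sum using (inj₁; inj₂)
open import Data.Product using (_×_; _,_; Σ-syntax; ∃-syntax)

BipGraph : ℕ → Set
BipGraph n = Fin n → Fin n → Bool

EdgeVar : ℕ → Set
EdgeVar n = Fin n × Fin n

Orientation : ℕ → Set
Orientation n = Fin n → Fin n → Bool

SignMatrix : ℕ → Set
SignMatrix n = Fin n → Fin n → Bool

module _ {c ℓ} (R : CommutativeRing c ℓ) where

  open CommutativeRing R
    using (0#; 1#)
    renaming (Carrier to K; _+_ to _+K_; _*_ to _*K_; -_ to -K_; _≈_ to _≈K_)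

  -- The polynomial ring R[X]: polynomial expressions modulo the
  -- congruence generated by the commutative ring axioms together with
  -- the ring structure of the constants (i.e. the free commutative
  -- R-algebra on the variable set X).
  infixl 6 _⊕_
  infixl 7 _⊗_
  infix 4 _≈P_

  data Poly (X : Set) : Set c where
    con : K → Poly X
    var : X → Poly X
    _⊕_ : Poly X → Poly X → Poly X
    _⊗_ : Poly X → Poly X → Poly X
    ⊖_  : Poly X → Poly X

  data _≈P_ {X : Set} : Poly X → Poly X → Set (c ⊔ ℓ) where
    ≈-refl  : ∀ {p} → p ≈P p
    ≈-sym   : ∀ {p q} → p ≈P q → q ≈P p
    ≈-trans : ∀ {p q r} → p ≈P q → q ≈P r → p ≈P r
    ⊕-cong  : ∀ {p p′ q q′} → p ≈P p′ → q ≈P q′ → p ⊕ q ≈P p′ ⊕ q′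
    ⊗-cong  : ∀ {p p′ q q′} → p ≈P p′ → q ≈P q′ → p ⊗ q ≈P p′ ⊗ q′
    ⊖-cong  : ∀ {p p′} → p ≈P p′ → ⊖ p ≈P ⊖ p′
    con-cong : ∀ {a b} → a ≈K b → con a ≈P con b
    con-+   : ∀ a b → con (a +K b) ≈P con a ⊕ con b
    con-*   : ∀ a b → con (a *K b) ≈P con a ⊗ con b
    con--   : ∀ a → con (-K a) ≈P ⊖ con a
    ⊕-assoc : ∀ p q r → (p ⊕ q) ⊕ r ≈P p ⊕ (q ⊕ r)
    ⊕-comm  : ∀ p q → p ⊕ q ≈P q ⊕ p
    ⊕-identityʳ : ∀ p → p ⊕ con 0# ≈P p
    ⊖-inverseʳ  : ∀ p → p ⊕ ⊖ p ≈P con 0#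
    ⊗-assoc : ∀ p q r → (p ⊗ q) ⊗ r ≈P p ⊗ (q ⊗ r)
    ⊗-comm  : ∀ p q → p ⊗ q ≈P q ⊗ p
    ⊗-identityʳ : ∀ p → p ⊗ con 1# ≈P p
    distribˡ : ∀ p q r → p ⊗ (q ⊕ r) ≈P p ⊗ q ⊕ p ⊗ r

  module _ {X : Set} where

    ∑ : ∀ m → (Fin m → Poly X) → Poly X
    ∑ zero    f = con 0#
    ∑ (suc m) f = f zero ⊕ ∑ m (λ i → f (suc i))

    alt : ℕ → Poly X → Poly X
    alt zero    p = p
    alt (suc k) p = ⊖ alt k p

    Matrix : ℕ → Set c
    Matrix m = Fin m → Fin m → Poly X

    det : ∀ m → Matrix m → Poly X
    det zero    M = con 1#
    det (suc m) M = ∑ (suc m) λ j →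
      alt (toℕ j) (M zero j ⊗ det m (λ a b → M (suc a) (punchIn j b)))

    per : ∀ m → Matrix m → Poly X
    per zero    M = con 1#
    per (suc m) M = ∑ (suc m) λ j →
      M zero j ⊗ per m (λ a b → M (suc a) (punchIn j b))

    Pf : ∀ m → Matrix m → Poly X
    Pf zero          A = con 1#
    Pf (suc zero)    A = con 0#
    Pf (suc (suc m)) A = ∑ (suc m) λ j →
      alt (toℕ j) (A zero (suc j) ⊗
        Pf m (λ a b → A (suc (punchIn j a)) (suc (punchIn j b))))

    -- Sum over perfect matchings of a weighted (symmetric) adjacency
    -- matrix W: vertex 1 is matched to some j, then recurse on the rest.
    -- Each perfect matching is enumerated exactly once.
    PMsum : ∀ m → Matrix m → Poly X
    PMsum zero          W = con 1#
    PMsum (suc zero)    W = con 0#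
    PMsum (suc (suc m)) W = ∑ (suc m) λ j →
      W zero (suc j) ⊗
        PMsum m (λ a b → W (suc (punchIn j a)) (suc (punchIn j b)))

  -- Bipartite graphs G = (U ⊔ V, E), U = V = Fin n, given by the
  -- adjacency relation adj u v (uv ∈ E).  Edge variables x_{uv} are
  -- indexed by Fin n × Fin n (only those with uv ∈ E ever occur).
  -- The vertex set of G is ordered as U (vertices 0..n-1) followed by
  -- V (vertices n..2n-1), via Fin (n + n).


  biadj : ∀ {n} → BipGraph n → Matrix {EdgeVar n} n
  biadj G u v = if G u v then var (u , v) else con 0#

  wadj : ∀ {n} → BipGraph n → Matrix {EdgeVar n} (n + n)
  wadj {n} G i j with splitAt n i | splitAt n j
  ... | inj₁ u | inj₂ v = biadj G u v
  ... | inj₂ v | inj₁ u = biadj G u v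
  ... | _      | _      = con 0#

  PM : ∀ {n} → BipGraph n → Poly (EdgeVar n)
  PM {n} G = PMsum (n + n) (wadj G)

  -- An orientation of G: D u v = true  means the edge uv is oriented
  -- u → v, false means v → u (value irrelevant on non-edges).

  oriented : ∀ {n} → BipGraph n → Orientation n → Fin n → Fin n → Poly (EdgeVar n)
  oriented G D u v =
    if G u v then (if D u v then var (u , v) else ⊖ var (u , v)) else con 0#

  skewAdj : ∀ {n} → BipGraph n → Orientation n → Matrix {EdgeVar n} (n + n)
  skewAdj {n} G D i j with splitAt n i | splitAt n j
  ... | inj₁ u | inj₂ v = oriented G D u v
  ... | inj₂ v | inj₁ u = ⊖ oriented G D u v
  ... | _      | _      = con 0#

  IsKPfaffian : ∀ {n} → BipGraph n → ℕ → Set (c ⊔ ℓ)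
  IsKPfaffian {n} G k =
    Σ[ D ∈ (Fin k → Orientation n) ] Σ[ cs ∈ (Fin k → K) ]
      PM G ≈P ∑ k (λ i → con (cs i) ⊗ Pf (n + n) (skewAdj G (D i)))

  -- pf(G) ≤ k : the least positive k′ with G k′-Pfaffian is ≤ k,
  -- i.e. G is k′-Pfaffian for some 1 ≤ k′ ≤ k.
  PfNumLe : ∀ {n} → BipGraph n → ℕ → Set (c ⊔ ℓ)
  PfNumLe G k = ∃[ k′ ] (1 ≤ k′ × k′ ≤ k × IsKPfaffian G k′)

  -- sign matrices S ∈ {±1}^{n×n}: true = +1, false = -1

  _∘ₛ_ : ∀ {X : Set} {n} → SignMatrix n → Matrix {X} n → Matrix {X} n
  (S ∘ₛ M) u v = if S u v then M u v else ⊖ M u v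

{-# OPTIONS --safe #-}
-- Order the vertices of G as U before V.  The weighted adjacency matrix and every
-- skew-adjacency matrix A_D then have a zero U×U block, with U×V block B_G, resp. the
-- entrywise signed matrix D ∘ B_G.  Expanding PM(G), resp. Pf(A_D), along the first row,
-- which is always a U-vertex, only V-columns contribute, and the recursion becomes the
-- first-row expansion of per(B_G), resp. det(D ∘ B_G), up to the global sign (-1)^(n C 2).
-- So a k′-Pfaffian representation of PM(G) is a representation of per(B_G) by k′
-- determinants with the orientations as sign matrices; pad it with zero coefficients.
module Submission where

open import Defs
open import Algebra.Bundles using (CommutativeRing)
open import Data.Nat using (ℕ)
open import Data.Fin using (Fin)
open import Data.Product using (Σ-syntax)

open import Level using (_⊔_)
open import Algebra.Structures using (IsCommutativeRing)
open import Algebra.Morphism.Structures using (module MonoidMorphisms)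
import Algebra.Properties.Ring as RingProperties
import Algebra.Properties.CommutativeSemigroup as CommutativeSemigroupProperties
import Algebra.Properties.Semiring.Exp as SemiringExp
open import Data.Bool using (true; false)
open import Data.Empty using (⊥-elim)
open import Data.Fin using (zero; suc; toℕ; punchIn; splitAt)
open import Data.Fin.Properties using (toℕ<n; toℕ-injective; toℕ-↑ˡ; toℕ-↑ʳ; splitAt-↑ˡ; splitAt-↑ʳ; splitAt-<)
open import Data.Nat using (zero; suc; _+_; _≤_; _<_; z≤n; s≤s; z<s; s<s; +-0-rawMonoid)
open import Data.Nat.Combinatorics using (_C_; nC1≡n; nCk+nC[k+1]≡[n+1]C[k+1])
open import Data.Nat.Properties using (+-suc; +-monoʳ-≤; +-monoʳ-<; <-≤-trans; m≤m+n; ≤-<-connex; suc-injective; 0≢1+n)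
open import Data.Product using (_×_; _,_; proj₁; proj₂)
open import Data.Sum using (inj₁; inj₂)
open import Data.Vec using (lookup; padRight; tabulate)
open import Data.Vec.Properties using (lookup-replicate)
open import Function using (_∘_)
open import Relation.Binary.PropositionalEquality as ≡ using (_≡_)

toℕ-punchIn-< : ∀ {m} (j : Fin (suc m)) (a : Fin m) → toℕ a < toℕ j → toℕ (punchIn j a) ≡ toℕ a
toℕ-punchIn-< (suc j) zero    _         = ≡.refl
toℕ-punchIn-< (suc j) (suc a) (s<s a<j) = ≡.cong suc (toℕ-punchIn-< j a a<j)

toℕ-punchIn-≥ : ∀ {m} (j : Fin (suc m)) (a : Fin m) → toℕ j ≤ toℕ a → toℕ (punchIn j a) ≡ suc (toℕ a)
toℕ-punchIn-≥ zero    a       _         = ≡.refl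
toℕ-punchIn-≥ (suc j) (suc a) (s≤s j≤a) = ≡.cong suc (toℕ-punchIn-≥ j a j≤a)

toℕ-punchIn-+ : ∀ n {m k} {j : Fin (suc m)} {v : Fin (suc k)} {b : Fin m} {w : Fin k} →
                toℕ j ≡ n + toℕ v → toℕ b ≡ n + toℕ w →
                toℕ (punchIn j b) ≡ n + toℕ (punchIn v w)
toℕ-punchIn-+ n {j = j} {v} {b} {w} j≡n+v b≡n+w with ≤-<-connex (toℕ v) (toℕ w)
... | inj₁ v≤w = begin
  toℕ (punchIn j b)       ≡⟨ toℕ-punchIn-≥ j b (≡.subst₂ _≤_ (≡.sym j≡n+v) (≡.sym b≡n+w) (+-monoʳ-≤ n v≤w)) ⟩
  suc (toℕ b)             ≡⟨ ≡.cong suc b≡n+w ⟩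
  suc (n + toℕ w)         ≡⟨ +-suc n (toℕ w) ⟨
  n + suc (toℕ w)         ≡⟨ ≡.cong (n +_) (toℕ-punchIn-≥ v w v≤w) ⟨
  n + toℕ (punchIn v w)   ∎
  where open ≡.≡-Reasoning
... | inj₂ w<v = begin
  toℕ (punchIn j b)       ≡⟨ toℕ-punchIn-< j b (≡.subst₂ _<_ (≡.sym b≡n+w) (≡.sym j≡n+v) (+-monoʳ-< n w<v)) ⟩
  toℕ b                   ≡⟨ b≡n+w ⟩
  n + toℕ w               ≡⟨ ≡.cong (n +_) (toℕ-punchIn-< v w w<v) ⟨
  n + toℕ (punchIn v w)   ∎
  where open ≡.≡-Reasoning

splitAt-toℕ-↑ˡ : ∀ m {n} {i : Fin (m + n)} {u : Fin m} → toℕ i ≡ toℕ u → splitAt m i ≡ inj₁ u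
splitAt-toℕ-↑ˡ m {n} {i} {u} i≡u =
  ≡.trans (≡.cong (splitAt m) (toℕ-injective (≡.trans i≡u (≡.sym (toℕ-↑ˡ u n))))) (splitAt-↑ˡ m u n)

splitAt-toℕ-↑ʳ : ∀ m {n} {i : Fin (m + n)} {v : Fin n} → toℕ i ≡ m + toℕ v → splitAt m i ≡ inj₂ v
splitAt-toℕ-↑ʳ m {n} {i} {v} i≡m+v =
  ≡.trans (≡.cong (splitAt m) (toℕ-injective (≡.trans i≡m+v (≡.sym (toℕ-↑ʳ m v))))) (splitAt-↑ʳ m n v)

suc-C-2 : ∀ n → suc n C 2 ≡ n + n C 2
suc-C-2 n = ≡.trans (≡.sym (nCk+nC[k+1]≡[n+1]C[k+1] n 1)) (≡.cong (_+ n C 2) (nC1≡n n))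

module PolynomialRing {c ℓ} (R : CommutativeRing c ℓ) (X : Set) where

  isCommutativeRing : IsCommutativeRing (_≈P_ R {X}) _⊕_ _⊗_ ⊖_ (con _) (con _)
  isCommutativeRing = record
    { isRing = record
      { +-isAbelianGroup = record
        { isGroup = record
          { isMonoid = record
            { isSemigroup = record
              { isMagma = record
                { isEquivalence = record { refl = ≈-refl ; sym = ≈-sym ; trans = ≈-trans }
                ; ∙-cong = ⊕-cong }
              ; assoc = ⊕-assoc }
            ; identity = (λ p → ≈-trans (⊕-comm _ p) (⊕-identityʳ p)) , ⊕-identityʳ }
          ; inverse = (λ p → ≈-trans (⊕-comm _ p) (⊖-inverseʳ p)) , ⊖-inverseʳ
          ; ⁻¹-cong = ⊖-cong }
        ; comm = ⊕-comm }
      ; *-cong = ⊗-cong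
      ; *-assoc = ⊗-assoc
      ; *-identity = (λ p → ≈-trans (⊗-comm _ p) (⊗-identityʳ p)) , ⊗-identityʳ
      ; distrib = distribˡ , λ p q r →
          ≈-trans (⊗-comm (q ⊕ r) p) (≈-trans (distribˡ p q r) (⊕-cong (⊗-comm p q) (⊗-comm p r))) }
    ; *-comm = ⊗-comm }

  commutativeRing : CommutativeRing c (c ⊔ ℓ)
  commutativeRing = record { isCommutativeRing = isCommutativeRing }

module Expansions {c ℓ} (R : CommutativeRing c ℓ) (X : Set) where

  open CommutativeRing R using ()
    renaming ( Carrier to K; 1# to 1ᴷ; -_ to -ᴷ_; refl to reflᴷ; sym to symᴷ
             ; *-identityˡ to *ᴷ-identityˡ; *-rawMonoid to *ᴷ-rawMonoid; semiring to semiringᴷ; ring to ringᴷ )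
  open PolynomialRing R X using (commutativeRing)
  open CommutativeRing commutativeRing hiding (zero; distribˡ; _+_; _*_; -_)
  open RingProperties ring using (-‿distribˡ-*)
  open CommutativeSemigroupProperties *-commutativeSemigroup using (interchange; x∙yz≈y∙xz)
  open SemiringExp semiringᴷ using (^-homo-*) renaming (_^_ to _^ᴷ_)
  open MonoidMorphisms +-0-rawMonoid *ᴷ-rawMonoid using (IsMonoidHomomorphism)
  open import Relation.Binary.Reasoning.Setoid setoid

  P : Set c
  P = Poly R X

  Mat : ℕ → Set c
  Mat = Matrix R {X}

  ∑-cong : ∀ {m} {f g : Fin m → P} → (∀ i → f i ≈ g i) → ∑ R m f ≈ ∑ R m g
  ∑-cong {zero}  f≈g = refl
  ∑-cong {suc m} f≈g = +-cong (f≈g zero) (∑-cong (f≈g ∘ suc))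

  ∑-zero : ∀ {m} {f : Fin m → P} → (∀ i → f i ≈ 0#) → ∑ R m f ≈ 0#
  ∑-zero {zero}  f≈0 = refl
  ∑-zero {suc m} f≈0 = trans (+-cong (f≈0 zero) (∑-zero (f≈0 ∘ suc))) (+-identityˡ 0#)

  *-distribˡ-∑ : ∀ p {m} (f : Fin m → P) → p ⊗ ∑ R m f ≈ ∑ R m (λ i → p ⊗ f i)
  *-distribˡ-∑ p {zero}  f = zeroʳ p
  *-distribˡ-∑ p {suc m} f = trans (distribˡ p _ _) (+-congˡ (*-distribˡ-∑ p (f ∘ suc)))

  ∑-skip : ∀ a {b m} → m ≡ a + b → (f : Fin m → P) (g : Fin b → P) →
           (∀ j → toℕ j < a → f j ≈ 0#) → (∀ j v → toℕ j ≡ a + toℕ v → f j ≈ g v) →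
           ∑ R m f ≈ ∑ R b g
  ∑-skip zero    ≡.refl f g _     f≈g = ∑-cong (λ v → f≈g v v ≡.refl)
  ∑-skip (suc a) ≡.refl f g f≈0 f≈g = begin
    f zero ⊕ ∑ R _ (f ∘ suc)  ≈⟨ +-cong (f≈0 zero z<s) (∑-skip a ≡.refl (f ∘ suc) g
                                   (λ j j<a → f≈0 (suc j) (s<s j<a))
                                   (λ j v j≡a+v → f≈g (suc j) v (≡.cong suc j≡a+v))) ⟩
    0# ⊕ ∑ R _ g              ≈⟨ +-identityˡ _ ⟩
    ∑ R _ g                   ∎

  ∑-padRight : ∀ {a} {A : Set a} {m k} (m≤k : m ≤ k) (h : A → P) (d : A) (f : Fin m → A) →
               h d ≈ 0# → ∑ R k (h ∘ lookup (padRight m≤k d (tabulate f))) ≈ ∑ R m (h ∘ f)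
  ∑-padRight z≤n       h d f hd≈0 = ∑-zero (λ i → trans (reflexive (≡.cong h (lookup-replicate i d))) hd≈0)
  ∑-padRight (s≤s m≤k) h d f hd≈0 = +-congˡ (∑-padRight m≤k h d (f ∘ suc) hd≈0)

  pfMinor : ∀ {m} → Mat (suc (suc m)) → Fin (suc m) → Mat m
  pfMinor A j a b = A (suc (punchIn j a)) (suc (punchIn j b))

  laplaceMinor : ∀ {m} → Mat (suc m) → Fin (suc m) → Mat m
  laplaceMinor M j a b = M (suc a) (punchIn j b)

  -- With ε = (-1)^_ these are Pf and det, with ε = 1 they are PMsum and per.
  module _ (ε : ℕ → K) where

    pfaffianExpansion : ∀ m → Mat m → P
    pfaffianExpansion zero          A = 1#
    pfaffianExpansion (suc zero)    A = 0#
    pfaffianExpansion (suc (suc m)) A = ∑ R (suc m) λ j →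
      con (ε (toℕ j)) ⊗ (A zero (suc j) ⊗ pfaffianExpansion m (pfMinor A j))

    laplaceExpansion : ∀ m → Mat m → P
    laplaceExpansion zero    M = 1#
    laplaceExpansion (suc m) M = ∑ R (suc m) λ j →
      con (ε (toℕ j)) ⊗ (M zero j ⊗ laplaceExpansion m (laplaceMinor M j))

    laplaceExpansion-cong : ∀ m {M N : Mat m} → (∀ a b → M a b ≈ N a b) →
                            laplaceExpansion m M ≈ laplaceExpansion m N
    laplaceExpansion-cong zero    M≈N = refl
    laplaceExpansion-cong (suc m) M≈N = ∑-cong λ j →
      *-congˡ {con (ε (toℕ j))} (*-cong (M≈N zero j) (laplaceExpansion-cong m (λ a b → M≈N (suc a) (punchIn j b))))

  -- U-rows are i < n and V-columns j ≥ n.  Only U-rows are constrained: expanding along the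
  -- first row of such a matrix never reaches the others.
  record BipartiteBlock (n : ℕ) {m} (A : Mat m) (B : Mat n) : Set (c ⊔ ℓ) where
    field
      UU≈0 : ∀ {i j} → toℕ i < n → toℕ j < n → A i j ≈ 0#
      UV≈B : ∀ {i j u v} → toℕ i ≡ toℕ u → toℕ j ≡ n + toℕ v → A i j ≈ B u v

  BipartiteBlock-minor : ∀ {n m} {A : Mat (suc (suc m))} {B : Mat (suc n)} {j v} →
                         BipartiteBlock (suc n) A B → toℕ j ≡ n + toℕ v →
                         BipartiteBlock n (pfMinor A j) (laplaceMinor B v)
  BipartiteBlock-minor {n} {j = j} {v} blk j≡n+v = record
    { UU≈0 = λ a<n b<n → UU≈0 (s<s (punchIn-preserves-U a<n)) (s<s (punchIn-preserves-U b<n))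
    ; UV≈B = λ {a} {_} {u} a≡u b≡n+w →
        UV≈B (≡.cong suc (≡.trans (punchIn-fixes-U (≡.subst (_< n) (≡.sym a≡u) (toℕ<n u))) a≡u))
             (≡.cong suc (toℕ-punchIn-+ n j≡n+v b≡n+w))
    }
    where
    open BipartiteBlock blk
    punchIn-fixes-U : ∀ {a} → toℕ a < n → toℕ (punchIn j a) ≡ toℕ a
    punchIn-fixes-U {a} a<n = toℕ-punchIn-< j a (<-≤-trans a<n (≡.subst (n ≤_) (≡.sym j≡n+v) (m≤m+n n (toℕ v))))
    punchIn-preserves-U : ∀ {a} → toℕ a < n → toℕ (punchIn j a) < n
    punchIn-preserves-U a<n = ≡.subst (_< n) (≡.sym (punchIn-fixes-U a<n)) a<n

  module _ {ε : ℕ → K} (ε-hom : IsMonoidHomomorphism ε) where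

    open IsMonoidHomomorphism ε-hom using (homo; ε-homo)

    con-ε-+ : ∀ a b → con (ε (a + b)) ≈ con (ε a) ⊗ con (ε b)
    con-ε-+ a b = trans (con-cong (homo a b)) (con-* _ _)

    -- The first row is a U-vertex, so only the V-columns j = n + v survive; their weight
    -- ε (n + v) splits off ε n, and these factors accumulate to ε (n C 2).
    pfaffianExpansion-block : ∀ n {m} → m ≡ n + n → {A : Mat m} {B : Mat n} → BipartiteBlock n A B →
                              pfaffianExpansion ε m A ≈ con (ε (n C 2)) ⊗ laplaceExpansion ε n B
    pfaffianExpansion-block zero    {zero}        _    _ =
      trans (sym (*-identityʳ 1#)) (*-congʳ (con-cong (symᴷ ε-homo)))
    pfaffianExpansion-block (suc n) {suc zero}    size _ =
      ⊥-elim (0≢1+n (≡.trans (suc-injective size) (+-suc n n)))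
    pfaffianExpansion-block (suc n) {suc (suc m)} size {A} {B} blk = begin
      ∑ R (suc m) (λ j → con (ε (toℕ j)) ⊗ (A zero (suc j) ⊗ pfaffianExpansion ε m (pfMinor A j)))
        ≈⟨ ∑-skip n (suc-injective size) _ _ U-columns V-columns ⟩
      ∑ R (suc n) (λ v → con (ε (n + toℕ v)) ⊗ (B zero v ⊗ (con (ε (n C 2)) ⊗ L v)))
        ≈⟨ ∑-cong regroup ⟩
      ∑ R (suc n) (λ v → con (ε (suc n C 2)) ⊗ (con (ε (toℕ v)) ⊗ (B zero v ⊗ L v)))
        ≈⟨ *-distribˡ-∑ _ (λ v → con (ε (toℕ v)) ⊗ (B zero v ⊗ L v)) ⟨
      con (ε (suc n C 2)) ⊗ laplaceExpansion ε (suc n) B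
        ∎
      where
      open BipartiteBlock blk
      L : Fin (suc n) → P
      L v = laplaceExpansion ε n (laplaceMinor B v)

      U-columns : ∀ j → toℕ j < n → con (ε (toℕ j)) ⊗ (A zero (suc j) ⊗ _) ≈ 0#
      U-columns j j<n = trans (*-congˡ (trans (*-congʳ (UU≈0 z<s (s<s j<n))) (zeroˡ _))) (zeroʳ _)

      V-columns : ∀ j v → toℕ j ≡ n + toℕ v →
                  con (ε (toℕ j)) ⊗ (A zero (suc j) ⊗ pfaffianExpansion ε m (pfMinor A j)) ≈
                  con (ε (n + toℕ v)) ⊗ (B zero v ⊗ (con (ε (n C 2)) ⊗ L v))
      V-columns j v j≡n+v = *-cong (reflexive (≡.cong (con ∘ ε) j≡n+v))
        (*-cong (UV≈B ≡.refl (≡.cong suc j≡n+v))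
          (pfaffianExpansion-block n (suc-injective (≡.trans (suc-injective size) (+-suc n n)))
            (BipartiteBlock-minor blk j≡n+v)))

      regroup : ∀ v → con (ε (n + toℕ v)) ⊗ (B zero v ⊗ (con (ε (n C 2)) ⊗ L v)) ≈
                      con (ε (suc n C 2)) ⊗ (con (ε (toℕ v)) ⊗ (B zero v ⊗ L v))
      regroup v = begin
        con (ε (n + toℕ v)) ⊗ (B zero v ⊗ (con (ε (n C 2)) ⊗ L v))
          ≈⟨ *-cong (con-ε-+ n (toℕ v)) (x∙yz≈y∙xz (B zero v) _ _) ⟩
        (con (ε n) ⊗ con (ε (toℕ v))) ⊗ (con (ε (n C 2)) ⊗ (B zero v ⊗ L v))
          ≈⟨ interchange _ _ _ _ ⟩
        (con (ε n) ⊗ con (ε (n C 2))) ⊗ (con (ε (toℕ v)) ⊗ (B zero v ⊗ L v))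
          ≈⟨ *-congʳ (trans (reflexive (≡.cong (con ∘ ε) (suc-C-2 n))) (con-ε-+ n (n C 2))) ⟨
        con (ε (suc n C 2)) ⊗ (con (ε (toℕ v)) ⊗ (B zero v ⊗ L v))
          ∎

  alternatingSign : ℕ → K
  alternatingSign k = (-ᴷ 1ᴷ) ^ᴷ k

  trivialSign : ℕ → K
  trivialSign _ = 1ᴷ

  alternatingSign-isMonoidHomomorphism : IsMonoidHomomorphism alternatingSign
  alternatingSign-isMonoidHomomorphism = record
    { isMagmaHomomorphism = record
      { isRelHomomorphism = record { cong = λ { ≡.refl → reflᴷ } }
      ; homo = ^-homo-* (-ᴷ 1ᴷ) }
    ; ε-homo = reflᴷ }

  trivialSign-isMonoidHomomorphism : IsMonoidHomomorphism trivialSign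
  trivialSign-isMonoidHomomorphism = record
    { isMagmaHomomorphism = record
      { isRelHomomorphism = record { cong = λ _ → reflᴷ }
      ; homo = λ _ _ → symᴷ (*ᴷ-identityˡ 1ᴷ) }
    ; ε-homo = reflᴷ }

  alt≈alternatingSign* : ∀ k p → alt R k p ≈ con (alternatingSign k) ⊗ p
  alt≈alternatingSign* zero    p = sym (*-identityˡ p)
  alt≈alternatingSign* (suc k) p = begin
    ⊖ alt R k p                                   ≈⟨ -‿cong (alt≈alternatingSign* k p) ⟩
    ⊖ (con (alternatingSign k) ⊗ p)               ≈⟨ -‿distribˡ-* _ p ⟩
    ⊖ con (alternatingSign k) ⊗ p                 ≈⟨ *-congʳ (con-- _) ⟨
    con (-ᴷ alternatingSign k) ⊗ p                ≈⟨ *-congʳ (con-cong (RingProperties.-1*x≈-x ringᴷ _)) ⟨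
    con (alternatingSign (suc k)) ⊗ p             ∎

  Pf≈pfaffianExpansion : ∀ m (A : Mat m) → Pf R m A ≈ pfaffianExpansion alternatingSign m A
  Pf≈pfaffianExpansion zero          A = refl
  Pf≈pfaffianExpansion (suc zero)    A = refl
  Pf≈pfaffianExpansion (suc (suc m)) A = ∑-cong λ j →
    trans (alt≈alternatingSign* (toℕ j) (A zero (suc j) ⊗ Pf R m (pfMinor A j)))
          (*-congˡ (*-congˡ (Pf≈pfaffianExpansion m (pfMinor A j))))

  det≈laplaceExpansion : ∀ m (M : Mat m) → det R m M ≈ laplaceExpansion alternatingSign m M
  det≈laplaceExpansion zero    M = refl
  det≈laplaceExpansion (suc m) M = ∑-cong λ j →
    trans (alt≈alternatingSign* (toℕ j) (M zero j ⊗ det R m (laplaceMinor M j)))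
          (*-congˡ (*-congˡ (det≈laplaceExpansion m (laplaceMinor M j))))

  PMsum≈pfaffianExpansion : ∀ m (A : Mat m) → PMsum R m A ≈ pfaffianExpansion trivialSign m A
  PMsum≈pfaffianExpansion zero          A = refl
  PMsum≈pfaffianExpansion (suc zero)    A = refl
  PMsum≈pfaffianExpansion (suc (suc m)) A = ∑-cong λ j →
    trans (*-congˡ {A zero (suc j)} (PMsum≈pfaffianExpansion m (pfMinor A j))) (sym (*-identityˡ _))

  per≈laplaceExpansion : ∀ m (M : Mat m) → per R m M ≈ laplaceExpansion trivialSign m M
  per≈laplaceExpansion zero    M = refl
  per≈laplaceExpansion (suc m) M = ∑-cong λ j →
    trans (*-congˡ {M zero j} (per≈laplaceExpansion m (laplaceMinor M j))) (sym (*-identityˡ _))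

module BipartiteGraph {c ℓ} (R : CommutativeRing c ℓ) {n} (G : BipGraph n) where

  open Expansions R (EdgeVar n)
  open PolynomialRing R (EdgeVar n) using (commutativeRing)
  open CommutativeRing commutativeRing hiding (zero; distribˡ; _+_; _*_; -_)
  open RingProperties ring using (-0#≈0#)
  open import Relation.Binary.Reasoning.Setoid setoid

  wadj-block : BipartiteBlock n (wadj R G) (biadj R G)
  wadj-block = record { UU≈0 = UU≈0 ; UV≈B = UV≈B }
    where
    UU≈0 : ∀ {i j} → toℕ i < n → toℕ j < n → wadj R G i j ≈ 0#
    UU≈0 {i} {j} i<n j<n rewrite splitAt-< n i i<n | splitAt-< n j j<n = refl
    UV≈B : ∀ {i j u v} → toℕ i ≡ toℕ u → toℕ j ≡ n + toℕ v → wadj R G i j ≈ biadj R G u v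
    UV≈B i≡u j≡n+v rewrite splitAt-toℕ-↑ˡ n i≡u | splitAt-toℕ-↑ʳ n j≡n+v = refl

  skewAdj-block : ∀ D → BipartiteBlock n (skewAdj R G D) (oriented R G D)
  skewAdj-block D = record { UU≈0 = UU≈0 ; UV≈B = UV≈B }
    where
    UU≈0 : ∀ {i j} → toℕ i < n → toℕ j < n → skewAdj R G D i j ≈ 0#
    UU≈0 {i} {j} i<n j<n rewrite splitAt-< n i i<n | splitAt-< n j j<n = refl
    UV≈B : ∀ {i j u v} → toℕ i ≡ toℕ u → toℕ j ≡ n + toℕ v → skewAdj R G D i j ≈ oriented R G D u v
    UV≈B i≡u j≡n+v rewrite splitAt-toℕ-↑ˡ n i≡u | splitAt-toℕ-↑ʳ n j≡n+v = refl

  oriented≈signed : ∀ D u v → oriented R G D u v ≈ _∘ₛ_ R D (biadj R G) u v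
  oriented≈signed D u v with G u v | D u v
  ... | true  | true  = refl
  ... | true  | false = refl
  ... | false | true  = refl
  ... | false | false = sym -0#≈0#

  per≈PM : per R n (biadj R G) ≈ PM R G
  per≈PM = begin
    per R n (biadj R G)                                      ≈⟨ per≈laplaceExpansion n _ ⟩
    laplaceExpansion trivialSign n (biadj R G)               ≈⟨ *-identityˡ _ ⟨
    1# ⊗ laplaceExpansion trivialSign n (biadj R G)          ≈⟨ pfaffianExpansion-block trivialSign-isMonoidHomomorphism n ≡.refl wadj-block ⟨
    pfaffianExpansion trivialSign (n + n) (wadj R G)         ≈⟨ PMsum≈pfaffianExpansion (n + n) _ ⟨
    PM R G                                                   ∎

  Pf≈det : ∀ D → Pf R (n + n) (skewAdj R G D) ≈ con (alternatingSign (n C 2)) ⊗ det R n (_∘ₛ_ R D (biadj R G))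
  Pf≈det D = begin
    Pf R (n + n) (skewAdj R G D)
      ≈⟨ Pf≈pfaffianExpansion (n + n) _ ⟩
    pfaffianExpansion alternatingSign (n + n) (skewAdj R G D)
      ≈⟨ pfaffianExpansion-block alternatingSign-isMonoidHomomorphism n ≡.refl (skewAdj-block D) ⟩
    con (alternatingSign (n C 2)) ⊗ laplaceExpansion alternatingSign n (oriented R G D)
      ≈⟨ *-congˡ (laplaceExpansion-cong alternatingSign n (oriented≈signed D)) ⟩
    con (alternatingSign (n C 2)) ⊗ laplaceExpansion alternatingSign n (_∘ₛ_ R D (biadj R G))
      ≈⟨ *-congˡ (det≈laplaceExpansion n _) ⟨
    con (alternatingSign (n C 2)) ⊗ det R n (_∘ₛ_ R D (biadj R G))
      ∎

corollary2p2 : ∀ {c ℓ} (R : CommutativeRing c ℓ) (n : ℕ) (G : BipGraph n) (k : ℕ) →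
    PfNumLe R G k →
    Σ[ S ∈ (Fin k → SignMatrix n) ] Σ[ cs ∈ (Fin k → CommutativeRing.Carrier R) ]
      _≈P_ R (per R n (biadj R G))
        (∑ R k (λ i → con (cs i) ⊗ det R n (_∘ₛ_ R (S i) (biadj R G))))
corollary2p2 R n G k (k′ , _ , k′≤k , D , cs , PM≈∑Pf) = proj₁ ∘ padded , proj₂ ∘ padded , (begin
  per R n (biadj R G)                                           ≈⟨ per≈PM ⟩
  PM R G                                                        ≈⟨ PM≈∑Pf ⟩
  ∑ R k′ (λ i → con (cs i) ⊗ Pf R (n + n) (skewAdj R G (D i)))  ≈⟨ ∑-cong (λ i → absorb-sign (cs i) (D i)) ⟩
  ∑ R k′ (term ∘ signed)                                        ≈⟨ ∑-padRight k′≤k term padding signed (zeroˡ _) ⟨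
  ∑ R k (term ∘ padded)                                         ∎)
  where
  open CommutativeRing R using (0#) renaming (Carrier to K; _*_ to _*ᴷ_)
  open Expansions R (EdgeVar n)
  open BipartiteGraph R G
  open PolynomialRing R (EdgeVar n) using (commutativeRing)
  open CommutativeRing commutativeRing using (_≈_; setoid; zeroˡ; *-assoc; *-congˡ; *-congʳ; trans; sym)
  open import Relation.Binary.Reasoning.Setoid setoid

  s : K
  s = alternatingSign (n C 2)

  term : SignMatrix n × K → Poly R (EdgeVar n)
  term (S , a) = con a ⊗ det R n (_∘ₛ_ R S (biadj R G))

  signed : Fin k′ → SignMatrix n × K
  signed i = D i , cs i *ᴷ s

  padding : SignMatrix n × K
  padding = (λ _ _ → true) , 0#

  padded : Fin k → SignMatrix n × K
  padded = lookup (padRight k′≤k padding (tabulate signed))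

  absorb-sign : ∀ a D → con a ⊗ Pf R (n + n) (skewAdj R G D) ≈ term (D , a *ᴷ s)
  absorb-sign a D = trans (*-congˡ (Pf≈det D)) (trans (sym (*-assoc _ _ _)) (*-congʳ (sym (con-* a s))))
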